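{- Let $M\subseteq\{\vee,\neg,\mathrm{dep}\}$. Then $\mathrm{MC}^{>\log_2(n)}(M)$ is trivial: for every Kripke structure $W=(S,R,\pi)$ and every $\varphi\in\mathrm{MDL}(M)$ such that the number of positive dependence atoms in $\varphi$ is greater than $\log_2(|S|)$, it holds for all $T\subseteq S$ that $W,T\models\varphi$.
   Context: Modal dependence logic (MDL). Let $AP$ be a set of atomic propositions. MDL formulae include atomic propositions $q$, negated atomic propositions $\neg q$, dependence atoms $\mathrm{dep}(p_1,\dots,p_n;q)$ and negated dependence atoms $\neg\mathrm{dep}(p_1,\dots,p_n;q)$ ($q,p_1,\dots,p_n\in AP$, $n\geq0$), combined with connectives such as dependence disjunction $\vee$ (negation occurs only in front of atomic propositions and dependence atoms). A Kripke structure is $W=(S,R,\pi)$ with $S$ a non-empty set, $R\subseteq S\times S$, $\pi:S\to\mathcal P(AP)$. Formulae are evaluated on teams $T\subseteq S$: $W,T\models p$ iff $p\in\pi(s)$ for all $s\in T$; $W,T\models\neg p$ iff $p\notin\pi(s)$ for all $s\in T$; $W,T\models\mathrm{dep}(p_1,\dots,p_n;q)$ iff for all $s_1,s_2\in T$ with $\pi(s_1)\cap\{p_1,\dots,p_n\}=\pi(s_2)\cap\{p_1,\dots,p_n\}$ we have $\pi(s_1)\cap\{q\}=\pi(s_2)\cap\{q\}$; $W,T\models\neg\mathrm{dep}(p_1,\dots,p_n;q)$ iff $T=\emptyset$; $W,T\models\varphi\vee\psi$ iff there are $T_1,T_2$ with $T=T_1\cup T_2$, $W,T_1\models\varphi$,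 $W,T_2\models\psi$. $\mathrm{MDL}(M)$ is the set of formulae built from atomic propositions using only the operators in $M$. For a formula $\varphi$, $\sigma(\varphi)$ is the number of (occurrences of) positive, i.e. non-negated, dependence atoms in $\varphi$. $\mathrm{MC}^{>\log_2(n)}(M)$ is the model checking problem (given finite $W=(S,R,\pi)$, $T\subseteq S$, $\varphi\in\mathrm{MDL}(M)$, decide $W,T\models\varphi$) restricted to inputs with $\sigma(\varphi)>\log_2(|S|)$. -}

module Defs where

open import Data.Nat using (ℕ; zero; suc; _+_)
open import Data.Bool using (Bool; true; false; _∨_)
open import Data.Fin using (Fin)
open import Data.Fin.Subset as Sub using (Subset; _∪_; ⊥; inside)
open import Data.List using (List; []; _∷_)
import Data.List.Membership.Propositional as LMem
open import Data.List.Relation.Unary.Any using (Any)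
open import Data.Product using (Σ; _×_; ∃)
open import Relation.Binary.PropositionalEquality using (_≡_)

-- Finite Kripke structure over atomic propositions AP with state set S = Fin n.
-- (Non-emptiness of S is imposed as a hypothesis in the theorem.)
record Kripke (AP : Set) (n : ℕ) : Set where
  field
    R : Fin n → Fin n → Bool
    π : Fin n → AP → Bool

-- MDL formulae in negation normal form (negation only in front of atoms / dep atoms).
data Form (AP : Set) : Set where
  atom    : AP → Form AP
  negAtom : AP → Form AP
  dep     : List AP → AP → Form AP
  negDep  : List AP → AP → Form AP
  _∧ᶠ_    : Form AP → Form AP → Form AP
  _∨ᶠ_    : Form AP → Form AP → Form AP
  □_      : Form AP → Form AP
  ◇_      : Form AP → Form AP

data Op : Set where
  opOr opNeg opDep opAnd opBox opDia : Op

data InFrag {AP : Set} (M : List Op) : Form AP → Set where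
  atom    : ∀ p → InFrag M (atom p)
  negAtom : ∀ p → opNeg LMem.∈ M → InFrag M (negAtom p)
  dep     : ∀ ps q → opDep LMem.∈ M → InFrag M (dep ps q)
  negDep  : ∀ ps q → opNeg LMem.∈ M → opDep LMem.∈ M → InFrag M (negDep ps q)
  and     : ∀ {φ ψ} → opAnd LMem.∈ M → InFrag M φ → InFrag M ψ → InFrag M (φ ∧ᶠ ψ)
  or      : ∀ {φ ψ} → opOr LMem.∈ M → InFrag M φ → InFrag M ψ → InFrag M (φ ∨ᶠ ψ)
  box     : ∀ {φ} → opBox LMem.∈ M → InFrag M φ → InFrag M (□ φ)
  dia     : ∀ {φ} → opDia LMem.∈ M → InFrag M φ → InFrag M (◇ φ)

σ : {AP : Set} → Form AP → ℕ
σ (atom _)    = 0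
σ (negAtom _) = 0
σ (dep _ _)   = 1
σ (negDep _ _) = 0
σ (φ ∧ᶠ ψ)   = σ φ + σ ψ
σ (φ ∨ᶠ ψ)   = σ φ + σ ψ
σ (□ φ)      = σ φ
σ (◇ φ)      = σ φ

module _ {AP : Set} {n : ℕ} (W : Kripke AP n) where
  open Kripke W

  IsImage : Subset n → Subset n → Set
  IsImage T T' = ∀ t → (t Sub.∈ T' → ∃ λ s → s Sub.∈ T × R s t ≡ true)
                     × ((∃ λ s → s Sub.∈ T × R s t ≡ true) → t Sub.∈ T')

  _⊨_ : Subset n → Form AP → Set
  T ⊨ atom p      = ∀ s → s Sub.∈ T → π s p ≡ true
  T ⊨ negAtom p   = ∀ s → s Sub.∈ T → π s p ≡ false
  T ⊨ dep ps q    = ∀ s₁ s₂ → s₁ Sub.∈ T → s₂ Sub.∈ T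
                    → (∀ p → p LMem.∈ ps → π s₁ p ≡ π s₂ p) → π s₁ q ≡ π s₂ q
  T ⊨ negDep ps q = T ≡ ⊥
  T ⊨ (φ ∧ᶠ ψ)    = (T ⊨ φ) × (T ⊨ ψ)
  T ⊨ (φ ∨ᶠ ψ)    = Σ (Subset n) λ T₁ → Σ (Subset n) λ T₂ → T ≡ T₁ ∪ T₂ × (T₁ ⊨ φ) × (T₂ ⊨ ψ)
  T ⊨ (□ φ)       = ∀ T' → IsImage T T' → T' ⊨ φ
  T ⊨ (◇ φ)       = Σ (Subset n) λ T' →
                      (∀ t → t Sub.∈ T' → ∃ λ s → s Sub.∈ T × R s t ≡ true)
                    × (∀ s → s Sub.∈ T → ∃ λ t → t Sub.∈ T' × R s t ≡ true)
                    × (T' ⊨ φ)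

-- A team of size t can be split into a part satisfying a dependence atom dep(ps; q) and a
-- leftover of size at most t/2: keep the majority value of q.  Repeating this along the
-- disjuncts of φ ∈ MDL(∨, ¬, dep), a team T splits into a part satisfying φ and a leftover
-- of size at most |T| / 2^σ(φ).  Once 2^σ(φ) > |S| ≥ |T|, the leftover is empty.
module Submission where

open import Defs
open import Data.Nat using (ℕ; zero; suc; _+_; _*_; _^_; _<_; _≤_)
open import Data.Nat.Properties
open import Data.Nat.Logarithm using (⌊log₂_⌋; ⌊log₂⌋-mono-≤; ⌊log₂[2^n]⌋≡n)
open import Data.Bool using (Bool; true; false)
open import Data.Fin using (Fin)
open import Data.Vec using ([]; _∷_; tabulate)
open import Data.Vec.Properties using (lookup∘tabulate; []=⇒lookup; lookup⇒[]=)
open import Data.Fin.Subset using (Subset; _∈_; _∩_; _∪_; ∁; ⊥; ⊤; ∣_∣; inside; outside)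
open import Data.Fin.Subset.Properties
  using (∉⊥; ∪-identityˡ; ∪-identityʳ; ∪-comm; ∪-assoc; ∩-distribˡ-∪; ∪-inverseʳ; ∩-identityʳ; x∈p∩q⁻; x∈∁p⇒x∉p; ∣p∣≤n)
open import Data.List using (List; _∷_; [])
open import Data.List.Relation.Unary.All using (All)
import Data.List.Relation.Unary.All as All
open import Data.List.Relation.Unary.Any using (there)
import Data.List.Membership.Propositional as List
open import Data.Product using (_,_; proj₂)
open import Data.Sum using (_⊎_; inj₁; inj₂)
open import Data.Empty using (⊥-elim)
open import Relation.Binary.PropositionalEquality

private
  variable
    n : ℕ

∣p∣≡0⇒p≡⊥ : {p : Subset n} → ∣ p ∣ ≡ 0 → p ≡ ⊥
∣p∣≡0⇒p≡⊥ {p = []}          _  = refl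
∣p∣≡0⇒p≡⊥ {p = outside ∷ p} eq = cong (outside ∷_) (∣p∣≡0⇒p≡⊥ eq)

∣p∩q∣+∣p∩∁q∣≡∣p∣ : (p q : Subset n) → ∣ p ∩ q ∣ + ∣ p ∩ ∁ q ∣ ≡ ∣ p ∣
∣p∩q∣+∣p∩∁q∣≡∣p∣ []            []            = refl
∣p∩q∣+∣p∩∁q∣≡∣p∣ (outside ∷ p) (_       ∷ q) = ∣p∩q∣+∣p∩∁q∣≡∣p∣ p q
∣p∩q∣+∣p∩∁q∣≡∣p∣ (inside  ∷ p) (inside  ∷ q) = cong suc (∣p∩q∣+∣p∩∁q∣≡∣p∣ p q)
∣p∩q∣+∣p∩∁q∣≡∣p∣ (inside  ∷ p) (outside ∷ q) =
  trans (+-suc _ _) (cong suc (∣p∩q∣+∣p∩∁q∣≡∣p∣ p q))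

p≡p∩q∪p∩∁q : (p q : Subset n) → p ≡ (p ∩ q) ∪ (p ∩ ∁ q)
p≡p∩q∪p∩∁q p q = begin
  p                     ≡⟨ ∩-identityʳ p ⟨
  p ∩ ⊤                 ≡⟨ cong (p ∩_) (∪-inverseʳ q) ⟨
  p ∩ (q ∪ ∁ q)         ≡⟨ ∩-distribˡ-∪ p q (∁ q) ⟩
  p ∩ q ∪ p ∩ ∁ q       ∎
  where open ≡-Reasoning

2*m≤m+n : {m n : ℕ} → m ≤ n → 2 * m ≤ m + n
2*m≤m+n {m} m≤n = +-monoʳ-≤ m (subst (_≤ _) (sym (+-identityʳ m)) m≤n)

∣p∩q∣-or-∣p∩∁q∣-halves : (p q : Subset n) → 2 * ∣ p ∩ q ∣ ≤ ∣ p ∣ ⊎ 2 * ∣ p ∩ ∁ q ∣ ≤ ∣ p ∣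
∣p∩q∣-or-∣p∩∁q∣-halves p q with ≤-total ∣ p ∩ q ∣ ∣ p ∩ ∁ q ∣
... | inj₁ a≤b = inj₁ (subst (2 * ∣ p ∩ q ∣ ≤_) (∣p∩q∣+∣p∩∁q∣≡∣p∣ p q) (2*m≤m+n a≤b))
... | inj₂ b≤a = inj₂ (subst (2 * ∣ p ∩ ∁ q ∣ ≤_) (trans (+-comm ∣ p ∩ ∁ q ∣ ∣ p ∩ q ∣) (∣p∩q∣+∣p∩∁q∣≡∣p∣ p q)) (2*m≤m+n b≤a))

∈-tabulate⁻ : {c : Fin n → Bool} {x : Fin n} → x ∈ tabulate c → c x ≡ true
∈-tabulate⁻ {c = c} {x} x∈ = trans (sym (lookup∘tabulate c x)) ([]=⇒lookup x∈)

∈-∁-tabulate⁻ : {c : Fin n → Bool} {x : Fin n} → x ∈ ∁ (tabulate c) → c x ≡ false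
∈-∁-tabulate⁻ {c = c} {x} x∈∁ with c x in eq
... | false = refl
... | true  = ⊥-elim (x∈∁p⇒x∉p x∈∁ (lookup⇒[]= x _ (trans (lookup∘tabulate c x) eq)))

m*n≤o<m⇒n≡0 : {m n o : ℕ} → m * n ≤ o → o < m → n ≡ 0
m*n≤o<m⇒n≡0 {n = zero}  _      _   = refl
m*n≤o<m⇒n≡0 {m} {suc n} m*n≤o o<m = ⊥-elim (<⇒≱ o<m (≤-trans (m≤m*n m (suc n)) m*n≤o))

⌊log₂n⌋<k⇒n<2^k : {n k : ℕ} → ⌊log₂ n ⌋ < k → n < 2 ^ k
⌊log₂n⌋<k⇒n<2^k {n} {k} lt = ≰⇒> λ 2^k≤n → <⇒≱ lt (begin
  k                 ≡⟨ ⌊log₂[2^n]⌋≡n k ⟨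
  ⌊log₂ (2 ^ k) ⌋   ≤⟨ ⌊log₂⌋-mono-≤ 2^k≤n ⟩
  ⌊log₂ n ⌋         ∎)
  where open ≤-Reasoning

module _ {AP : Set} (W : Kripke AP n) where
  open Kripke W

  record Approximation (T : Subset n) (φ : Form AP) : Set where
    field
      satisfying residue : Subset n
      covers             : T ≡ satisfying ∪ residue
      satisfies          : _⊨_ W satisfying φ
      residue-small      : 2 ^ σ φ * ∣ residue ∣ ≤ ∣ T ∣

  open Approximation

  approximation-by-⊥ : {T : Subset n} {φ : Form AP} → σ φ ≡ 0 → _⊨_ W ⊥ φ → Approximation T φ
  approximation-by-⊥ {T} σφ≡0 ⊥⊨φ = record
    { satisfying    = ⊥
    ; residue       = T
    ; covers        = sym (∪-identityˡ T)
    ; satisfies     = ⊥⊨φ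
    ; residue-small = subst (λ k → 2 ^ k * ∣ T ∣ ≤ ∣ T ∣) (sym σφ≡0) (≤-reflexive (+-identityʳ _))
    }

  dep-approximation : (T : Subset n) (ps : List AP) (q : AP) → Approximation T (dep ps q)
  dep-approximation T ps q = keep-majority (∣p∩q∣-or-∣p∩∁q∣-halves T Q)
    where
    Q : Subset n
    Q = tabulate (λ s → π s q)

    keep-majority : 2 * ∣ T ∩ Q ∣ ≤ ∣ T ∣ ⊎ 2 * ∣ T ∩ ∁ Q ∣ ≤ ∣ T ∣ → Approximation T (dep ps q)
    keep-majority (inj₁ small) = record
      { satisfying    = T ∩ ∁ Q
      ; residue       = T ∩ Q
      ; covers        = trans (p≡p∩q∪p∩∁q T Q) (∪-comm _ _)
      ; satisfies     = λ s₁ s₂ s₁∈ s₂∈ _ →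
          trans (∈-∁-tabulate⁻ (proj₂ (x∈p∩q⁻ T _ s₁∈))) (sym (∈-∁-tabulate⁻ (proj₂ (x∈p∩q⁻ T _ s₂∈))))
      ; residue-small = small
      }
    keep-majority (inj₂ small) = record
      { satisfying    = T ∩ Q
      ; residue       = T ∩ ∁ Q
      ; covers        = p≡p∩q∪p∩∁q T Q
      ; satisfies     = λ s₁ s₂ s₁∈ s₂∈ _ →
          trans (∈-tabulate⁻ (proj₂ (x∈p∩q⁻ T _ s₁∈))) (sym (∈-tabulate⁻ (proj₂ (x∈p∩q⁻ T _ s₂∈))))
      ; residue-small = small
      }

  ∨-approximation : {T : Subset n} {φ ψ : Form AP} (a : Approximation T φ) →
                    Approximation (residue a) ψ → Approximation T (φ ∨ᶠ ψ)
  ∨-approximation {T} {φ} {ψ} a b = record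
    { satisfying    = satisfying a ∪ satisfying b
    ; residue       = residue b
    ; covers        = trans (covers a) (trans (cong (satisfying a ∪_) (covers b))
                                              (sym (∪-assoc _ _ _)))
    ; satisfies     = satisfying a , satisfying b , refl , satisfies a , satisfies b
    ; residue-small = begin
        2 ^ (σ φ + σ ψ) * ∣ residue b ∣      ≡⟨ cong (_* ∣ residue b ∣) (^-distribˡ-+-* 2 (σ φ) (σ ψ)) ⟩
        2 ^ σ φ * 2 ^ σ ψ * ∣ residue b ∣    ≡⟨ *-assoc (2 ^ σ φ) _ _ ⟩
        2 ^ σ φ * (2 ^ σ ψ * ∣ residue b ∣)  ≤⟨ *-monoʳ-≤ (2 ^ σ φ) (residue-small b) ⟩
        2 ^ σ φ * ∣ residue a ∣              ≤⟨ residue-small a ⟩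
        ∣ T ∣                                ∎
    }
    where open ≤-Reasoning

  approximate : {M : List Op} → All (List._∈ (opOr ∷ opNeg ∷ opDep ∷ [])) M →
                {φ : Form AP} → InFrag M φ → (T : Subset n) → Approximation T φ
  approximate _ (atom p)          T = approximation-by-⊥ refl λ _ s∈⊥ → ⊥-elim (∉⊥ s∈⊥)
  approximate _ (negAtom p _)     T = approximation-by-⊥ refl λ _ s∈⊥ → ⊥-elim (∉⊥ s∈⊥)
  approximate _ (dep ps q _)      T = dep-approximation T ps q
  approximate _ (negDep ps q _ _) T = approximation-by-⊥ refl refl
  approximate A (or _ fφ fψ)      T = ∨-approximation a (approximate A fψ (residue a))
    where a = approximate A fφ T
  approximate A (and o _ _) _ with All.lookup A o
  ... | there (there (there ()))
  approximate A (box o _)   _ with All.lookup A o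
  ... | there (there (there ()))
  approximate A (dia o _)   _ with All.lookup A o
  ... | there (there (there ()))

  ⊨-of-approximation : {T : Subset n} {φ : Form AP} → ∣ T ∣ < 2 ^ σ φ → Approximation T φ → _⊨_ W T φ
  ⊨-of-approximation {T} {φ} ∣T∣<2^σφ a = subst (λ X → _⊨_ W X φ) (sym T≡satisfying) (satisfies a)
    where
    residue≡⊥ : residue a ≡ ⊥
    residue≡⊥ = ∣p∣≡0⇒p≡⊥ (m*n≤o<m⇒n≡0 (residue-small a) ∣T∣<2^σφ)

    T≡satisfying : T ≡ satisfying a
    T≡satisfying = trans (covers a) (trans (cong (satisfying a ∪_) residue≡⊥) (∪-identityʳ _))

mainTheorem15 : {AP : Set} (M : List Op) → All (λ o → o List.∈ (opOr ∷ opNeg ∷ opDep ∷ [])) M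
    → (n : ℕ) → 1 ≤ n → (W : Kripke AP n) (φ : Form AP) → InFrag M φ
    → ⌊log₂ n ⌋ < σ φ
    → (T : Subset n) → _⊨_ W T φ
mainTheorem15 M A n _ W φ fφ log₂n<σφ T =
  ⊨-of-approximation W ∣T∣<2^σφ (approximate W A fφ T)
  where
  ∣T∣<2^σφ : ∣ T ∣ < 2 ^ σ φ
  ∣T∣<2^σφ = ≤-<-trans (∣p∣≤n T) (⌊log₂n⌋<k⇒n<2^k log₂n<σφ)
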